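{- Let $\mathcal{W}$ be a Kripke model and $W$ a world of $\mathcal{W}$, and suppose that $W$ admits arbitrarily large finite families of independent switches. Then every propositional modal formula that is valid at $W$ (with respect to substitution instances by assertions from a class containing these switches and closed under finite Boolean combinations) belongs to the modal theory S5.
   Context: A statement $s$ is a switch at a world $W$ of a Kripke model if both $\Diamond s$ and $\Diamond\neg s$ hold at every world reachable from $W$ (by successive applications of the accessibility relation). A family of switches $s_0,s_1,\dots$ is independent if from any such world one can access a world realizing any desired finite pattern of truth values for finitely many of the switches. A propositional modal formula $\varphi(p_0,\dots,p_n)$ is valid at $W$ for a class of assertions if every substitution instance $\varphi(\psi_0,\dots,\psi_n)$ with $\psi_i$ from the class is true at $W$ (modal operators interpreted by the Kripke accessibility relation). -}

module Defs where

open import Level using (0ℓ)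
open import Data.Nat using (ℕ)
open import Data.Fin using (Fin)
open import Data.Bool using (Bool; true; false; not; _∧_; _∨_)
open import Data.Product using (Σ; ∃; _×_; _,_)
open import Data.Sum using (_⊎_)
open import Data.Unit using (⊤)
open import Data.Empty using (⊥)
open import Relation.Nullary using (¬_)
open import Relation.Binary.PropositionalEquality using (_≡_)
open import Relation.Binary.Construct.Closure.ReflexiveTransitive using (Star)

record KripkeModel : Set₁ where
  field
    World : Set
    _⇝_   : World → World → Set

module _ (𝓦 : KripkeModel) where
  open KripkeModel 𝓦

  Assertion : Set₁
  Assertion = World → Set

  Reachable : World → World → Set
  Reachable = Star _⇝_

  ◇ₐ : Assertion → World → Set
  ◇ₐ s U = Σ World λ V → (U ⇝ V) × s V

  □ₐ : Assertion → World → Set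
  □ₐ s U = (V : World) → U ⇝ V → s V

  IsSwitch : Assertion → World → Set
  IsSwitch s W = (U : World) → Reachable W U →
                 ◇ₐ s U × ◇ₐ (λ V → ¬ s V) U

  Realizes : {n : ℕ} → (Fin n → Assertion) → (Fin n → Bool) → World → Set
  Realizes {n} s b V = (i : Fin n) → Pattern (b i) (s i V)
    where
      Pattern : Bool → Set → Set
      Pattern true  P = P
      Pattern false P = ¬ P

  IndependentSwitches : {n : ℕ} → (Fin n → Assertion) → World → Set
  IndependentSwitches {n} s W =
    ((i : Fin n) → IsSwitch (s i) W) ×
    ((U : World) → Reachable W U → (b : Fin n → Bool) →
       Σ World λ V → (U ⇝ V) × Realizes s b V)

  BooleanClosed : (Assertion → Set₁) → Set₁
  BooleanClosed C =
    C (λ _ → ⊤) × C (λ _ → ⊥) ×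
    (∀ s → C s → C (λ U → ¬ s U)) ×
    (∀ s t → C s → C t → C (λ U → s U × t U)) ×
    (∀ s t → C s → C t → C (λ U → s U ⊎ t U)) ×
    (∀ s t → C s → C t → C (λ U → s U → t U))

infixr 5 _⇒_
infixr 6 _∨'_
infixr 7 _∧'_

data Form : Set where
  var  : ℕ → Form
  ⊥'   : Form
  ¬'_  : Form → Form
  _∧'_ : Form → Form → Form
  _∨'_ : Form → Form → Form
  _⇒_  : Form → Form → Form
  □    : Form → Form
  ◇    : Form → Form

module _ (𝓦 : KripkeModel) where
  open KripkeModel 𝓦

  ⟦_⟧ : Form → (ℕ → Assertion 𝓦) → World → Set
  ⟦ var i ⟧  σ U = σ i U
  ⟦ ⊥' ⟧     σ U = ⊥
  ⟦ ¬' φ ⟧   σ U = ¬ ⟦ φ ⟧ σ U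
  ⟦ φ ∧' ψ ⟧ σ U = ⟦ φ ⟧ σ U × ⟦ ψ ⟧ σ U
  ⟦ φ ∨' ψ ⟧ σ U = ⟦ φ ⟧ σ U ⊎ ⟦ ψ ⟧ σ U
  ⟦ φ ⇒ ψ ⟧  σ U = ⟦ φ ⟧ σ U → ⟦ ψ ⟧ σ U
  ⟦ □ φ ⟧    σ U = □ₐ 𝓦 (⟦ φ ⟧ σ) U
  ⟦ ◇ φ ⟧    σ U = ◇ₐ 𝓦 (⟦ φ ⟧ σ) U

  ValidAt : (Assertion 𝓦 → Set₁) → World → Form → Set₁
  ValidAt C W φ = (σ : ℕ → Assertion 𝓦) → ((i : ℕ) → C (σ i)) → ⟦ φ ⟧ σ W

-- Boolean evaluation treating variables and modal subformulas as atoms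
evalB : (Form → Bool) → Form → Bool
evalB v (var i)  = v (var i)
evalB v ⊥'       = false
evalB v (¬' φ)   = not (evalB v φ)
evalB v (φ ∧' ψ) = evalB v φ ∧ evalB v ψ
evalB v (φ ∨' ψ) = evalB v φ ∨ evalB v ψ
evalB v (φ ⇒ ψ)  = not (evalB v φ) ∨ evalB v ψ
evalB v (□ φ)    = v (□ φ)
evalB v (◇ φ)    = v (◇ φ)

Tautology : Form → Set
Tautology φ = (v : Form → Bool) → evalB v φ ≡ true

data S5 : Form → Set where
  taut  : ∀ {φ} → Tautology φ → S5 φ
  dual₁ : ∀ {φ} → S5 (◇ φ ⇒ ¬' □ (¬' φ))
  dual₂ : ∀ {φ} → S5 (¬' □ (¬' φ) ⇒ ◇ φ)
  axK   : ∀ {φ ψ} → S5 (□ (φ ⇒ ψ) ⇒ □ φ ⇒ □ ψ)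
  axT   : ∀ {φ} → S5 (□ φ ⇒ φ)
  ax4   : ∀ {φ} → S5 (□ φ ⇒ □ (□ φ))
  ax5   : ∀ {φ} → S5 (◇ φ ⇒ □ (◇ φ))
  mp    : ∀ {φ ψ} → S5 (φ ⇒ ψ) → S5 φ → S5 ψ
  nec   : ∀ {φ} → S5 φ → S5 (□ φ)

-- Suppose φ ∉ S5 and take as atoms the variables and modal subformulas of φ.
-- Truth assignments to the atoms whose literals are S5-consistent form a finite
-- canonical model: fix one, c₀, refuting φ, and call an assignment good if it is
-- consistent and agrees with c₀ on the modal atoms.  Since modal literals are
-- necessitated in S5, a good assignment refuting □ χ has a good companion
-- refuting χ.  Given as many independent switches as atoms, every reachable world
-- sees every truth pattern of the switches, so decoding the pattern of a world
-- (translated so that W decodes to c₀) makes every good assignment visible from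
-- every reachable world.  Interpreting the variable p as the Boolean combination
-- of switches "the assignment of this world derives p", a truth lemma shows that
-- at reachable worlds a formula over the atoms holds iff the assignment of the
-- world derives it; at W this falsifies the instance of φ.

module Submission where

open import Defs
open import Level using (0ℓ)
open import Data.Nat using (ℕ)
open import Data.Fin using (Fin; zero; suc)
open import Data.Maybe using (Maybe; just; nothing)
open import Data.Bool using (Bool; true; false; not; _∨_; _xor_; T)
open import Data.Bool.Properties using (T-≡; T-∧; T-∨; xor-assoc; xor-same; xor-identityʳ)
open import Data.Unit using (⊤; tt)
open import Data.Empty using (⊥; ⊥-elim)
open import Data.Product using (Σ; _×_; _,_; proj₁; proj₂)
open import Data.Product.Function.NonDependent.Propositional using (_×-⇔_)
open import Data.Sum using (_⊎_; inj₁; inj₂; [_,_]; map₂)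
open import Data.Sum.Function.Propositional using (_⊎-⇔_)
open import Data.List using (List; []; _∷_; _++_)
import Data.List as List
open import Data.List.Membership.Propositional using (_∈_)
open import Data.List.Membership.Propositional.Properties using (∈-++⁺ˡ; ∈-++⁺ʳ)
open import Data.List.Relation.Unary.Any using (here; there)
open import Data.Vec using (Vec; []; _∷_; lookup; zipWith; replicate; tabulate; fromList)
open import Data.Vec.Properties using (lookup-zipWith; tabulate-cong; tabulate∘lookup)
open import Data.Vec.Membership.Propositional using () renaming (_∈_ to _∈ᵥ_)
open import Data.Vec.Membership.Propositional.Properties using (∈-fromList⁺)
open import Data.Vec.Relation.Unary.Any using (index)
open import Data.Vec.Relation.Unary.Any.Properties using (lookup-index)
open import Data.Vec.Relation.Binary.Pointwise.Inductive using (Pointwise; []; _∷_)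
import Data.Vec.Relation.Binary.Pointwise.Inductive as Pointwise
open import Data.List.Relation.Unary.All using (All; []; _∷_)
open import Data.List.Relation.Unary.All.Properties using (map⁺)
open import Function.Base using (_∘_)
open import Function.Bundles using (_⇔_; mk⇔; Equivalence)
open import Function.Construct.Composition using (_⇔-∘_)
open import Function.Related.TypeIsomorphisms using (→-cong-⇔; ¬-cong-⇔)
open import Relation.Nullary using (¬_; Dec; yes; no; does)
open import Relation.Nullary.Decidable using (T?; decidable-stable; dec-true; dec-false)
import Relation.Nullary.Decidable as Dec
open import Relation.Binary.PropositionalEquality
  using (_≡_; refl; sym; trans; cong; cong₂; subst; module ≡-Reasoning)
open import Axiom.ExcludedMiddle using (ExcludedMiddle)
open import Relation.Binary.Construct.Closure.ReflexiveTransitive using (ε; _◅_; _◅◅_)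

open Equivalence using (to; from)
open ≡-Reasoning

infix 4 _⊨_ _⊢_

⊤' : Form
⊤' = ¬' ⊥'

lit : Bool → Form → Form
lit true  φ = φ
lit false φ = ¬' φ

-- A Set-valued copy of evalB (they agree by T-evalB), so that the tautologies
-- used below are proved by λ-terms.
_⊨_ : (Form → Bool) → Form → Set
v ⊨ var i    = T (v (var i))
v ⊨ ⊥'       = ⊥
v ⊨ ¬' φ     = ¬ v ⊨ φ
v ⊨ φ ∧' ψ   = v ⊨ φ × v ⊨ ψ
v ⊨ φ ∨' ψ   = v ⊨ φ ⊎ v ⊨ ψ
v ⊨ φ ⇒ ψ    = v ⊨ φ → v ⊨ ψ
v ⊨ □ φ      = T (v (□ φ))
v ⊨ ◇ φ      = T (v (◇ φ))

T-not : ∀ {x} → T (not x) ⇔ (¬ T x)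
T-not {true}  = mk⇔ (λ ()) (λ ¬t → ¬t tt)
T-not {false} = mk⇔ (λ _ ()) (λ _ → tt)

T-implies : ∀ {x y} → T (not x ∨ y) ⇔ (T x → T y)
T-implies {true}  = mk⇔ (λ t _ → t) (λ f → f tt)
T-implies {false} = mk⇔ (λ _ ()) (λ _ → tt)

T-evalB : ∀ v φ → T (evalB v φ) ⇔ v ⊨ φ
T-evalB v (var i)  = mk⇔ (λ t → t) (λ t → t)
T-evalB v ⊥'       = mk⇔ (λ ()) (λ ())
T-evalB v (¬' φ)   = ¬-cong-⇔ (T-evalB v φ) ⇔-∘ T-not
T-evalB v (φ ∧' ψ) = (T-evalB v φ ×-⇔ T-evalB v ψ) ⇔-∘ T-∧
T-evalB v (φ ∨' ψ) = (T-evalB v φ ⊎-⇔ T-evalB v ψ) ⇔-∘ T-∨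
T-evalB v (φ ⇒ ψ)  = →-cong-⇔ (T-evalB v φ) (T-evalB v ψ) ⇔-∘ T-implies
T-evalB v (□ φ)    = mk⇔ (λ t → t) (λ t → t)
T-evalB v (◇ φ)    = mk⇔ (λ t → t) (λ t → t)

⊨-stable : ∀ v φ → ¬ ¬ v ⊨ φ → v ⊨ φ
⊨-stable v φ = decidable-stable (Dec.map (T-evalB v φ) (T? (evalB v φ)))

infixr 5 _⇛_

_⇛_ : List Form → Form → Form
[]      ⇛ φ = φ
(ψ ∷ Δ) ⇛ φ = ψ ⇒ Δ ⇛ φ

mp* : ∀ {Δ φ} → S5 (Δ ⇛ φ) → All S5 Δ → S5 φ
mp* h []       = h
mp* h (p ∷ ps) = mp* (mp h p) ps

S5-consequence : ∀ {Δ φ} → All S5 Δ → (∀ v → v ⊨ Δ ⇛ φ) → S5 φ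
S5-consequence {Δ} {φ} ps e = mp* (taut λ v → to T-≡ (from (T-evalB v (Δ ⇛ φ)) (e v))) ps

_⊢_ : Form → Form → Set
Γ ⊢ φ = S5 (Γ ⇒ φ)

⇛-under : ∀ {v Γ} Δ {φ} → (v ⊨ Γ → v ⊨ Δ ⇛ φ) → v ⊨ List.map (Γ ⇒_) Δ ⇛ Γ ⇒ φ
⇛-under []      e = e
⇛-under (ψ ∷ Δ) e = λ g → ⇛-under Δ λ γ → e γ (g γ)

⊢-consequence : ∀ {Γ Δ φ} → All (Γ ⊢_) Δ → (∀ v → v ⊨ Δ ⇛ φ) → Γ ⊢ φ
⊢-consequence {Δ = Δ} ps e = S5-consequence (map⁺ ps) λ v → ⇛-under Δ λ _ → e v

⇒-trans : ∀ {φ ψ χ} → S5 (φ ⇒ ψ) → S5 (ψ ⇒ χ) → S5 (φ ⇒ χ)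
⇒-trans h₁ h₂ = S5-consequence (h₁ ∷ h₂ ∷ []) λ _ f g t → g (f t)

dne : ∀ φ → S5 (¬' ¬' φ ⇒ φ)
dne φ = S5-consequence [] λ v → ⊨-stable v φ

dni : ∀ {φ} → S5 (φ ⇒ ¬' ¬' φ)
dni = S5-consequence [] λ _ x ¬x → ¬x x

□-mono : ∀ {φ ψ} → S5 (φ ⇒ ψ) → S5 (□ φ ⇒ □ ψ)
□-mono h = mp axK (nec h)

□-∧ : ∀ {φ ψ} → S5 (□ φ ⇒ □ ψ ⇒ □ (φ ∧' ψ))
□-∧ = ⇒-trans (□-mono (S5-consequence [] λ _ → _,_)) axK

◇-intro : ∀ {φ} → S5 (φ ⇒ ◇ φ)
◇-intro {φ} = ⇒-trans (S5-consequence (axT {¬' φ} ∷ []) λ _ t x b → t b x) dual₂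

Stable : Form → Set
Stable φ = S5 (φ ⇒ □ φ)

stable-⊤ : Stable ⊤'
stable-⊤ = S5-consequence (nec {⊤'} (taut λ _ → refl) ∷ []) λ _ b _ → b

stable-∧ : ∀ {φ ψ} → Stable φ → Stable ψ → Stable (φ ∧' ψ)
stable-∧ hφ hψ = S5-consequence (hφ ∷ hψ ∷ □-∧ ∷ []) λ _ f g k (x , y) → k (f x) (g y)

-- Every literal over a modal formula is necessitated: by 4 and 5 for the positive
-- ones, and for the negative ones by 5 resp. 4 after the duality ¬□ ↔ ◇¬.
stable-lit-□ : ∀ b φ → Stable (lit b (□ φ))
stable-lit-□ true  φ = ax4
stable-lit-□ false φ =
  S5-consequence (dual₂ {¬' φ} ∷ □-mono (dne φ) ∷ ax5 ∷ □-mono ◇¬⇒¬□ ∷ []) λ _ d e a m ¬b →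
    m (a (d λ b → ¬b (e b)))
  where
  ◇¬⇒¬□ : S5 (◇ (¬' φ) ⇒ ¬' □ φ)
  ◇¬⇒¬□ = S5-consequence (dual₁ ∷ □-mono dni ∷ []) λ _ d e x b → d x (e b)

stable-lit-◇ : ∀ b φ → Stable (lit b (◇ φ))
stable-lit-◇ true  φ = ax5
stable-lit-◇ false φ =
  S5-consequence (dual₂ {φ} ∷ ax4 ∷ □-mono □¬⇒¬◇ ∷ []) λ v d a m ¬x →
    m (a (⊨-stable v (□ (¬' φ)) λ ¬b → ¬x (d ¬b)))
  where
  □¬⇒¬◇ : S5 (□ (¬' φ) ⇒ ¬' ◇ φ)
  □¬⇒¬◇ = S5-consequence (dual₁ ∷ []) λ _ d b x → d x b

Decides : Form → Form → Set
Decides Γ φ = Γ ⊢ φ ⊎ Γ ⊢ ¬' φ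

lit-decides : ∀ {Γ φ} b → Γ ⊢ lit b φ → Decides Γ φ
lit-decides true  = inj₁
lit-decides false = inj₂

module _ {Γ : Form} where

  decides-⊥ : Decides Γ ⊥'
  decides-⊥ = inj₂ (⊢-consequence [] λ _ ())

  decides-¬ : ∀ {φ} → Decides Γ φ → Decides Γ (¬' φ)
  decides-¬ (inj₁ p) = inj₂ (⊢-consequence (p ∷ []) λ _ x ¬x → ¬x x)
  decides-¬ (inj₂ p) = inj₁ p

  decides-∧ : ∀ {φ ψ} → Decides Γ φ → Decides Γ ψ → Decides Γ (φ ∧' ψ)
  decides-∧ (inj₁ p) (inj₁ q) = inj₁ (⊢-consequence (p ∷ q ∷ []) λ _ → _,_)
  decides-∧ (inj₂ p) _        = inj₂ (⊢-consequence (p ∷ []) λ _ ¬x (x , _) → ¬x x)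
  decides-∧ _        (inj₂ q) = inj₂ (⊢-consequence (q ∷ []) λ _ ¬y (_ , y) → ¬y y)

  decides-∨ : ∀ {φ ψ} → Decides Γ φ → Decides Γ ψ → Decides Γ (φ ∨' ψ)
  decides-∨ (inj₁ p) _        = inj₁ (⊢-consequence (p ∷ []) λ _ → inj₁)
  decides-∨ _        (inj₁ q) = inj₁ (⊢-consequence (q ∷ []) λ _ → inj₂)
  decides-∨ (inj₂ p) (inj₂ q) = inj₂ (⊢-consequence (p ∷ q ∷ []) λ _ ¬x ¬y → [ ¬x , ¬y ])

  decides-⇒ : ∀ {φ ψ} → Decides Γ φ → Decides Γ ψ → Decides Γ (φ ⇒ ψ)
  decides-⇒ (inj₂ p) _        = inj₁ (⊢-consequence (p ∷ []) λ _ ¬x x → ⊥-elim (¬x x))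
  decides-⇒ _        (inj₁ q) = inj₁ (⊢-consequence (q ∷ []) λ _ y _ → y)
  decides-⇒ (inj₁ p) (inj₂ q) = inj₂ (⊢-consequence (p ∷ q ∷ []) λ _ x ¬y f → ¬y (f x))

  ⊢-∧ : ∀ {φ ψ} → (Γ ⊢ φ × Γ ⊢ ψ) ⇔ Γ ⊢ φ ∧' ψ
  ⊢-∧ = mk⇔ (λ (p , q) → ⊢-consequence (p ∷ q ∷ []) λ _ → _,_)
            (λ r → ⊢-consequence (r ∷ []) (λ _ → proj₁) , ⊢-consequence (r ∷ []) (λ _ → proj₂))

  ⊢-∨ : ∀ {φ ψ} → Decides Γ φ → (Γ ⊢ φ ⊎ Γ ⊢ ψ) ⇔ Γ ⊢ φ ∨' ψ
  ⊢-∨ d = mk⇔ [ (λ p → ⊢-consequence (p ∷ []) λ _ → inj₁) ,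
                (λ q → ⊢-consequence (q ∷ []) λ _ → inj₂) ]
              λ r → map₂ (λ ¬p → ⊢-consequence (r ∷ ¬p ∷ []) λ _ x∨y ¬x →
                                   [ ⊥-elim ∘ ¬x , (λ y → y) ] x∨y) d

  ⊢-⇒ : ∀ {φ ψ} → Decides Γ φ → (Γ ⊢ φ → Γ ⊢ ψ) ⇔ Γ ⊢ φ ⇒ ψ
  ⊢-⇒ (inj₁ p) = mk⇔ (λ f → ⊢-consequence (f p ∷ []) λ _ y _ → y)
                     (λ r q → ⊢-consequence (r ∷ q ∷ []) λ _ f x → f x)
  ⊢-⇒ (inj₂ ¬p) = mk⇔ (λ _ → ⊢-consequence (¬p ∷ []) λ _ ¬x x → ⊥-elim (¬x x))
                      (λ r q → ⊢-consequence (r ∷ q ∷ []) λ _ f x → f x)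

Consistent : Form → Set
Consistent Γ = ¬ S5 (¬' Γ)

module _ {Γ : Form} (consistent : Consistent Γ) where

  ⊢-contradiction : ∀ {φ} → Γ ⊢ φ → Γ ⊢ ¬' φ → ⊥
  ⊢-contradiction p q = consistent (S5-consequence (p ∷ q ∷ []) λ _ f g γ → g γ (f γ))

  ⊢-⊥ : ⊥ ⇔ Γ ⊢ ⊥'
  ⊢-⊥ = mk⇔ ⊥-elim λ p → consistent (S5-consequence (p ∷ []) λ _ f → f)

  ⊢-¬ : ∀ {φ} → Decides Γ φ → (¬ Γ ⊢ φ) ⇔ Γ ⊢ ¬' φ
  ⊢-¬ d = mk⇔ (λ ¬p → [ (λ p → ⊥-elim (¬p p)) , (λ q → q) ] d) λ q p → ⊢-contradiction p q

  lit-true : ∀ {φ} b → Γ ⊢ lit b φ → Γ ⊢ φ → b ≡ true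
  lit-true true  _ _ = refl
  lit-true false q p = ⊥-elim (⊢-contradiction p q)

AllAtoms : (Form → Set) → Form → Set
AllAtoms P (var i)  = P (var i)
AllAtoms P ⊥'       = ⊤
AllAtoms P (¬' φ)   = AllAtoms P φ
AllAtoms P (φ ∧' ψ) = AllAtoms P φ × AllAtoms P ψ
AllAtoms P (φ ∨' ψ) = AllAtoms P φ × AllAtoms P ψ
AllAtoms P (φ ⇒ ψ)  = AllAtoms P φ × AllAtoms P ψ
AllAtoms P (□ φ)    = P (□ φ) × AllAtoms P φ
AllAtoms P (◇ φ)    = P (◇ φ) × AllAtoms P φ

allAtoms-mono : ∀ {P Q : Form → Set} → (∀ {x} → P x → Q x) → ∀ φ → AllAtoms P φ → AllAtoms Q φ
allAtoms-mono f (var i)  c         = f c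
allAtoms-mono f ⊥'       c         = c
allAtoms-mono f (¬' φ)   c         = allAtoms-mono f φ c
allAtoms-mono f (φ ∧' ψ) (c₁ , c₂) = allAtoms-mono f φ c₁ , allAtoms-mono f ψ c₂
allAtoms-mono f (φ ∨' ψ) (c₁ , c₂) = allAtoms-mono f φ c₁ , allAtoms-mono f ψ c₂
allAtoms-mono f (φ ⇒ ψ)  (c₁ , c₂) = allAtoms-mono f φ c₁ , allAtoms-mono f ψ c₂
allAtoms-mono f (□ φ)    (p , c)   = f p , allAtoms-mono f φ c
allAtoms-mono f (◇ φ)    (p , c)   = f p , allAtoms-mono f φ c

atoms : Form → List Form
atoms (var i)  = var i ∷ []
atoms ⊥'       = []
atoms (¬' φ)   = atoms φ
atoms (φ ∧' ψ) = atoms φ ++ atoms ψ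
atoms (φ ∨' ψ) = atoms φ ++ atoms ψ
atoms (φ ⇒ ψ)  = atoms φ ++ atoms ψ
atoms (□ φ)    = □ φ ∷ atoms φ
atoms (◇ φ)    = ◇ φ ∷ atoms φ

allAtoms-∈-atoms : ∀ φ → AllAtoms (_∈ atoms φ) φ
allAtoms-∈-atoms-++ : ∀ φ ψ → AllAtoms (_∈ atoms φ ++ atoms ψ) φ ×
                              AllAtoms (_∈ atoms φ ++ atoms ψ) ψ

allAtoms-∈-atoms (var i)  = here refl
allAtoms-∈-atoms ⊥'       = tt
allAtoms-∈-atoms (¬' φ)   = allAtoms-∈-atoms φ
allAtoms-∈-atoms (φ ∧' ψ) = allAtoms-∈-atoms-++ φ ψ
allAtoms-∈-atoms (φ ∨' ψ) = allAtoms-∈-atoms-++ φ ψ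
allAtoms-∈-atoms (φ ⇒ ψ)  = allAtoms-∈-atoms-++ φ ψ
allAtoms-∈-atoms (□ φ)    = here refl , allAtoms-mono there φ (allAtoms-∈-atoms φ)
allAtoms-∈-atoms (◇ φ)    = here refl , allAtoms-mono there φ (allAtoms-∈-atoms φ)

allAtoms-∈-atoms-++ φ ψ = allAtoms-mono ∈-++⁺ˡ φ (allAtoms-∈-atoms φ) ,
                       allAtoms-mono (∈-++⁺ʳ (atoms φ)) ψ (allAtoms-∈-atoms ψ)

⋀ : ∀ {n} → Vec Form n → Form
⋀ []       = ⊤'
⋀ (φ ∷ φs) = φ ∧' ⋀ φs

⊨-⋀-lookup : ∀ {v n} (φs : Vec Form n) i → v ⊨ ⋀ φs → v ⊨ lookup φs i
⊨-⋀-lookup (φ ∷ φs) zero    (x , _)  = x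
⊨-⋀-lookup (φ ∷ φs) (suc i) (_ , xs) = ⊨-⋀-lookup φs i xs

literals : ∀ {n} → Vec Bool n → Vec Form n → Form
literals c a = ⋀ (zipWith lit c a)

literals-⊢-lookup : ∀ {n} (c : Vec Bool n) a i → literals c a ⊢ lit (lookup c i) (lookup a i)
literals-⊢-lookup c a i =
  S5-consequence [] λ v l →
    subst (v ⊨_) (lookup-zipWith lit i c a) (⊨-⋀-lookup (zipWith lit c a) i l)

literals-⊢-∈ : ∀ {n} (c : Vec Bool n) {a x} (x∈a : x ∈ᵥ a) →
               literals c a ⊢ lit (lookup c (index x∈a)) x
literals-⊢-∈ c {a} x∈a =
  subst (λ y → literals c a ⊢ lit (lookup c (index x∈a)) y) (sym (lookup-index x∈a))
        (literals-⊢-lookup c a _)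

data _≼_ : Bool → Maybe Bool → Set where
  fixed : ∀ {b} → b ≼ just b
  free  : ∀ {b} → b ≼ nothing

_Extends_ : ∀ {n} → Vec Bool n → Vec (Maybe Bool) n → Set
c Extends p = Pointwise _≼_ c p

extends-lookup : ∀ {n} {c : Vec Bool n} {p b} → c Extends p →
                 ∀ i → lookup p i ≡ just b → lookup c i ≡ b
extends-lookup e i eq = ≼-just (subst (_ ≼_) eq (Pointwise.lookup e i))
  where
  ≼-just : ∀ {b b'} → b ≼ just b' → b ≡ b'
  ≼-just fixed = refl

partial-lit : Maybe Bool → Form → Form
partial-lit (just b) φ = lit b φ
partial-lit nothing  φ = ⊤'

partial-literals : ∀ {n} → Vec (Maybe Bool) n → Vec Form n → Form
partial-literals p a = ⋀ (zipWith partial-lit p a)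

extends-⊢ : ∀ {n} {c : Vec Bool n} {p} → c Extends p → ∀ a → literals c a ⊢ partial-literals p a
extends-⊢ e a = S5-consequence [] λ v → ⊨-extends e a
  where
  ⊨-extends : ∀ {v n} {c : Vec Bool n} {p} → c Extends p → ∀ a →
              v ⊨ literals c a → v ⊨ partial-literals p a
  ⊨-extends []           []      t        = t
  ⊨-extends (fixed ∷ e) (x ∷ a) (l , ls) = l , ⊨-extends e a ls
  ⊨-extends (free ∷ e)  (x ∷ a) (_ , ls) = (λ ()) , ⊨-extends e a ls

case-split : ∀ {n} (a : Vec Form n) (p : Vec (Maybe Bool) n) {ψ} →
             (∀ c → c Extends p → literals c a ⊢ ψ) → partial-literals p a ⊢ ψ
case-split []      []      H = H [] []
case-split (x ∷ a) (m ∷ p) {ψ} H =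
  conclude m λ b r → case-split a p λ c e → shunt (H (b ∷ c) (r ∷ e))
  where
  shunt : ∀ {φ₁ φ₂ χ} → S5 (φ₁ ∧' φ₂ ⇒ χ) → S5 (φ₂ ⇒ φ₁ ⇒ χ)
  shunt h = S5-consequence (h ∷ []) λ _ f y x → f (x , y)
  conclude : ∀ m → (∀ b → b ≼ m → partial-literals p a ⊢ lit b x ⇒ ψ) →
             partial-lit m x ∧' partial-literals p a ⊢ ψ
  conclude (just b) h = S5-consequence (h b fixed ∷ []) λ _ g (y , l) → g l y
  conclude nothing  h = S5-consequence (h true free ∷ h false free ∷ []) λ v g₁ g₀ (_ , l) →
    ⊨-stable v ψ λ ¬ψ → ¬ψ (g₀ l λ y → ¬ψ (g₁ l y))

⊨-unconstrained : ∀ v {n} (a : Vec Form n) → v ⊨ partial-literals (replicate n nothing) a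
⊨-unconstrained v []      = λ ()
⊨-unconstrained v (_ ∷ a) = (λ ()) , ⊨-unconstrained v a

modalOnly : Bool → Form → Maybe Bool
modalOnly b (□ _) = just b
modalOnly b (◇ _) = just b
modalOnly _ _     = nothing

modalPart : ∀ {n} → Vec Bool n → Vec Form n → Vec (Maybe Bool) n
modalPart = zipWith modalOnly

≼-modalOnly : ∀ b x → b ≼ modalOnly b x
≼-modalOnly b (var _)  = free
≼-modalOnly b ⊥'       = free
≼-modalOnly b (¬' _)   = free
≼-modalOnly b (_ ∧' _) = free
≼-modalOnly b (_ ∨' _) = free
≼-modalOnly b (_ ⇒ _)  = free
≼-modalOnly b (□ _)    = fixed
≼-modalOnly b (◇ _)    = fixed

stable-modalOnly : ∀ b x → Stable (partial-lit (modalOnly b x) x)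
stable-modalOnly b (var _)  = stable-⊤
stable-modalOnly b ⊥'       = stable-⊤
stable-modalOnly b (¬' _)   = stable-⊤
stable-modalOnly b (_ ∧' _) = stable-⊤
stable-modalOnly b (_ ∨' _) = stable-⊤
stable-modalOnly b (_ ⇒ _)  = stable-⊤
stable-modalOnly b (□ φ)    = stable-lit-□ b φ
stable-modalOnly b (◇ φ)    = stable-lit-◇ b φ

extends-modalPart : ∀ {n} (c : Vec Bool n) a → c Extends modalPart c a
extends-modalPart []      []      = []
extends-modalPart (b ∷ c) (x ∷ a) = ≼-modalOnly b x ∷ extends-modalPart c a

stable-modalPart : ∀ {n} (c : Vec Bool n) a → Stable (partial-literals (modalPart c a) a)
stable-modalPart []      []      = stable-⊤
stable-modalPart (b ∷ c) (x ∷ a) = stable-∧ (stable-modalOnly b x) (stable-modalPart c a)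

data IsModal : Form → Set where
  is-□ : ∀ {φ} → IsModal (□ φ)
  is-◇ : ∀ {φ} → IsModal (◇ φ)

lookup-modalPart : ∀ {n} (c : Vec Bool n) a i → IsModal (lookup a i) →
                   lookup (modalPart c a) i ≡ just (lookup c i)
lookup-modalPart c a i m = trans (lookup-zipWith modalOnly i c a) (modalOnly-modal m)
  where
  modalOnly-modal : ∀ {b x} → IsModal x → modalOnly b x ≡ just b
  modalOnly-modal is-□ = refl
  modalOnly-modal is-◇ = refl

module Assignments {k : ℕ} (a : Vec Form k) where

  OverAtoms : Form → Set
  OverAtoms = AllAtoms (_∈ᵥ a)

  decided : ∀ ψ → OverAtoms ψ → ∀ c → Decides (literals c a) ψ
  decided (var i)  x∈a       c = lit-decides _ (literals-⊢-∈ c x∈a)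
  decided ⊥'       _         c = decides-⊥
  decided (¬' ψ)   cov       c = decides-¬ (decided ψ cov c)
  decided (ψ ∧' χ) (cψ , cχ) c = decides-∧ (decided ψ cψ c) (decided χ cχ c)
  decided (ψ ∨' χ) (cψ , cχ) c = decides-∨ (decided ψ cψ c) (decided χ cχ c)
  decided (ψ ⇒ χ)  (cψ , cχ) c = decides-⇒ (decided ψ cψ c) (decided χ cχ c)
  decided (□ ψ)    (x∈a , _) c = lit-decides _ (literals-⊢-∈ c x∈a)
  decided (◇ ψ)    (x∈a , _) c = lit-decides _ (literals-⊢-∈ c x∈a)

  module Classical (em : ExcludedMiddle 0ℓ) where

    ⊢-unless-refuted : ∀ {ψ} → OverAtoms ψ → ∀ c →
                       ¬ (Consistent (literals c a) × literals c a ⊢ ¬' ψ) → literals c a ⊢ ψ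
    ⊢-unless-refuted {ψ} cov c ¬refuted with em {S5 (¬' literals c a)}
    ... | yes inconsistent = S5-consequence (inconsistent ∷ []) λ _ ¬l l → ⊥-elim (¬l l)
    ... | no consistent    =
      [ (λ p → p) , (λ q → ⊥-elim (¬refuted (consistent , q))) ] (decided ψ cov c)

    provable-unless-refuted : ∀ {ψ} → OverAtoms ψ →
      (∀ c → ¬ (Consistent (literals c a) × literals c a ⊢ ¬' ψ)) → S5 ψ
    provable-unless-refuted {ψ} cov unrefuted =
      S5-consequence (case-split a (replicate k nothing) all⊢ψ ∷ []) λ v f → f (⊨-unconstrained v a)
      where
      all⊢ψ : ∀ c → c Extends replicate k nothing → literals c a ⊢ ψ
      all⊢ψ c _ = ⊢-unless-refuted cov c (unrefuted c)

    module Rooted (c₀ : Vec Bool k) where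

      Good : Vec Bool k → Set
      Good c = Consistent (literals c a) × c Extends modalPart c₀ a

      -- If no good c' refuted χ, every completion of the modal part of c₀ would
      -- derive χ; the modal part is necessitated, so it would derive □ χ.
      existence : ∀ {c χ} → Good c → OverAtoms χ → literals c a ⊢ ¬' □ χ →
                  Σ (Vec Bool k) λ c' → Good c' × literals c' a ⊢ ¬' χ
      existence {c} {χ} (consistent , c-ext) cov ⊢¬□χ
        with em {Σ (Vec Bool k) λ c' → Good c' × literals c' a ⊢ ¬' χ}
      ... | yes witness = witness
      ... | no none = ⊥-elim (⊢-contradiction consistent ⊢□χ ⊢¬□χ)
        where
        modal⊢χ : partial-literals (modalPart c₀ a) a ⊢ χ
        modal⊢χ = case-split a (modalPart c₀ a) λ c' ext →
          ⊢-unless-refuted cov c' λ (consistent' , ⊢¬χ) → none (c' , (consistent' , ext) , ⊢¬χ)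
        ⊢□χ : literals c a ⊢ □ χ
        ⊢□χ = ⇒-trans (extends-⊢ c-ext a) (⇒-trans (stable-modalPart c₀ a) (□-mono modal⊢χ))

      transfer : ∀ {c c' A} → Good c → Good c' → A ∈ᵥ a → IsModal A →
                 literals c a ⊢ A → literals c' a ⊢ A
      transfer {c} {c'} {A} (consistent , c-ext) (_ , c'-ext) A∈a modal ⊢A =
        subst (λ b → literals c' a ⊢ lit b A) c'ᵢ≡true (literals-⊢-∈ c' A∈a)
        where
        i = index A∈a
        c₀ᵢ : lookup (modalPart c₀ a) i ≡ just (lookup c₀ i)
        c₀ᵢ = lookup-modalPart c₀ a i (subst IsModal (lookup-index A∈a) modal)
        c'ᵢ≡true : lookup c' i ≡ true
        c'ᵢ≡true = begin
          lookup c' i ≡⟨ extends-lookup c'-ext i c₀ᵢ ⟩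
          lookup c₀ i ≡⟨ extends-lookup c-ext i c₀ᵢ ⟨
          lookup c i  ≡⟨ lit-true consistent _ (literals-⊢-∈ c A∈a) ⊢A ⟩
          true        ∎

T-does : ∀ {P : Set} (d : Dec P) → T (does d) ⇔ P
T-does (yes p) = mk⇔ (λ _ → p) (λ _ → tt)
T-does (no ¬p) = mk⇔ (λ ()) ¬p

module Switches (em : ExcludedMiddle 0ℓ) (𝓦 : KripkeModel) where
  open KripkeModel 𝓦

  truthPattern : ∀ {n} → (Fin n → Assertion 𝓦) → World → Vec Bool n
  truthPattern s U = tabulate λ i → does (em {s i U})

  truthPattern-realized : ∀ {n} (s : Fin n → Assertion 𝓦) (b : Vec Bool n) {V} →
                          Realizes 𝓦 s (lookup b) V → truthPattern s V ≡ b
  truthPattern-realized s b {V} r = trans (tabulate-cong agree) (tabulate∘lookup b)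
    where
    agree : ∀ i → does (em {s i V}) ≡ lookup b i
    agree i with lookup b i | r i
    ... | true  | p  = dec-true em p
    ... | false | ¬p = dec-false em ¬p

  Expressible : (Assertion 𝓦 → Set₁) → (World → Set) → Set₁
  Expressible C P = Σ (Assertion 𝓦) λ A → C A × (∀ U → A U ⇔ P U)

  -- Shannon expansion on the first switch.
  boolean-function-expressible : ∀ {C n} → BooleanClosed 𝓦 C →
    (s : Fin n → Assertion 𝓦) → (∀ i → C (s i)) →
    (f : Vec Bool n → Bool) → Expressible C λ U → T (f (truthPattern s U))
  boolean-function-expressible {n = ℕ.zero} (c⊤ , c⊥ , _) s _ f = constant (f [])
    where
    constant : ∀ b → Expressible _ λ _ → T b
    constant true  = (λ _ → ⊤) , c⊤ , λ _ → mk⇔ (λ _ → tt) (λ _ → tt)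
    constant false = (λ _ → ⊥) , c⊥ , λ _ → mk⇔ (λ ()) (λ ())
  boolean-function-expressible {C} {ℕ.suc n} bc@(_ , _ , c¬ , c× , c⊎ , _) s sC f =
    expand (boolean-function-expressible bc (s ∘ suc) (sC ∘ suc) (f ∘ (true ∷_)))
           (boolean-function-expressible bc (s ∘ suc) (sC ∘ suc) (f ∘ (false ∷_)))
    where
    rest = truthPattern (s ∘ suc)
    expand : Expressible C (λ U → T (f (true ∷ rest U))) →
             Expressible C (λ U → T (f (false ∷ rest U))) →
             Expressible C λ U → T (f (truthPattern s U))
    expand (A₁ , cA₁ , spec₁) (A₀ , cA₀ , spec₀) =
      (λ U → (s zero U × A₁ U) ⊎ (¬ s zero U × A₀ U)) ,
      c⊎ _ _ (c× _ _ (sC zero) cA₁) (c× _ _ (c¬ _ (sC zero)) cA₀) ,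
      spec
      where
      spec : ∀ U → ((s zero U × A₁ U) ⊎ (¬ s zero U × A₀ U)) ⇔ T (f (truthPattern s U))
      spec U with em {s zero U}
      ... | yes p = mk⇔ [ (λ (_ , x) → to (spec₁ U) x) , (λ (¬p , _) → ⊥-elim (¬p p)) ]
                        (λ t → inj₁ (p , from (spec₁ U) t))
      ... | no ¬p = mk⇔ [ (λ (p , _) → ⊥-elim (¬p p)) , (λ (_ , x) → to (spec₀ U) x) ]
                        (λ t → inj₂ (¬p , from (spec₀ U) t))

_⊕_ : ∀ {n} → Vec Bool n → Vec Bool n → Vec Bool n
_⊕_ = zipWith _xor_

⊕-cancelʳ : ∀ {n} (b d : Vec Bool n) → (b ⊕ d) ⊕ d ≡ b
⊕-cancelʳ []      []      = refl
⊕-cancelʳ (x ∷ b) (y ∷ d) = cong₂ _∷_ xor-cancelʳ (⊕-cancelʳ b d)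
  where
  xor-cancelʳ : (x xor y) xor y ≡ x
  xor-cancelʳ = begin
    (x xor y) xor y ≡⟨ xor-assoc x y y ⟩
    x xor (y xor y) ≡⟨ cong (x xor_) (xor-same y) ⟩
    x xor false     ≡⟨ xor-identityʳ x ⟩
    x               ∎

⊕-cancelˡ : ∀ {n} (d b : Vec Bool n) → d ⊕ (d ⊕ b) ≡ b
⊕-cancelˡ []      []      = refl
⊕-cancelˡ (x ∷ d) (y ∷ b) = cong₂ _∷_ xor-cancelˡ (⊕-cancelˡ d b)
  where
  xor-cancelˡ : x xor (x xor y) ≡ y
  xor-cancelˡ = begin
    x xor (x xor y) ≡⟨ xor-assoc x x y ⟨
    (x xor x) xor y ≡⟨ cong (_xor y) (xor-same x) ⟩
    false xor y     ≡⟨⟩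
    y               ∎

module CanonicalModel
  (em : ExcludedMiddle 0ℓ) (𝓦 : KripkeModel) (W : KripkeModel.World 𝓦)
  (C : Assertion 𝓦 → Set₁) (bc : BooleanClosed 𝓦 C)
  {k : ℕ} (a : Vec Form k) (c₀ : Vec Bool k) (c₀-consistent : Consistent (literals c₀ a))
  (s : Fin k → Assertion 𝓦) (independent : IndependentSwitches 𝓦 s W) (sC : ∀ i → C (s i))
  where
  open KripkeModel 𝓦
  open Assignments a
  open Classical em
  open Rooted c₀
  open Switches em 𝓦

  good-c₀ : Good c₀
  good-c₀ = c₀-consistent , extends-modalPart c₀ a

  toGood : Vec Bool k → Vec Bool k
  toGood c with em {Good c}
  ... | yes _ = c
  ... | no  _ = c₀

  toGood-good : ∀ c → Good (toGood c)
  toGood-good c with em {Good c}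
  ... | yes good = good
  ... | no  _    = good-c₀

  toGood-id : ∀ {c} → Good c → toGood c ≡ c
  toGood-id {c} good with em {Good c}
  ... | yes _   = refl
  ... | no  bad = ⊥-elim (bad good)

  offset : Vec Bool k
  offset = truthPattern s W ⊕ c₀

  decode : Vec Bool k → Vec Bool k
  decode b = toGood (b ⊕ offset)

  assignment : World → Vec Bool k
  assignment U = decode (truthPattern s U)

  Γ : World → Form
  Γ U = literals (assignment U) a

  good : ∀ U → Good (assignment U)
  good U = toGood-good _

  assignment-W : assignment W ≡ c₀
  assignment-W = trans (cong toGood (⊕-cancelˡ (truthPattern s W) c₀)) (toGood-id good-c₀)

  good-accessible : ∀ {U} → Reachable 𝓦 W U → ∀ {c} → Good c →
                    Σ World λ V → U ⇝ V × Reachable 𝓦 W V × assignment V ≡ c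
  good-accessible {U} r {c} gc with proj₂ independent U r (lookup (c ⊕ offset))
  ... | V , U⇝V , realizes = V , U⇝V , r ◅◅ (U⇝V ◅ ε) , (begin
    decode (truthPattern s V)      ≡⟨ cong decode (truthPattern-realized s (c ⊕ offset) realizes) ⟩
    toGood ((c ⊕ offset) ⊕ offset) ≡⟨ cong toGood (⊕-cancelʳ c offset) ⟩
    toGood c                       ≡⟨ toGood-id gc ⟩
    c                              ∎)

  valuation : ∀ j → Expressible C λ U → T (does (em {Γ U ⊢ var j}))
  valuation j = boolean-function-expressible bc s sC λ b → does (em {literals (decode b) a ⊢ var j})

  σ : ℕ → Assertion 𝓦
  σ j = proj₁ (valuation j)

  σ∈C : ∀ j → C (σ j)
  σ∈C j = proj₁ (proj₂ (valuation j))

  σ-spec : ∀ j {U} → σ j U ⇔ Γ U ⊢ var j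
  σ-spec j {U} = T-does em ⇔-∘ proj₂ (proj₂ (valuation j)) U

  consistent : ∀ U → Consistent (Γ U)
  consistent U = proj₁ (good U)

  module _ {ψ} (cov : OverAtoms ψ) (IH : ∀ {V} → Reachable 𝓦 W V → ⟦ 𝓦 ⟧ ψ σ V ⇔ Γ V ⊢ ψ) where

    truth-□ : □ ψ ∈ᵥ a → ∀ {U} → Reachable 𝓦 W U → ⟦ 𝓦 ⟧ (□ ψ) σ U ⇔ Γ U ⊢ □ ψ
    truth-□ □ψ∈a {U} r = mk⇔ necessary possible
      where
      necessary : ⟦ 𝓦 ⟧ (□ ψ) σ U → Γ U ⊢ □ ψ
      necessary h = [ (λ p → p) , refuted ] (decided (□ ψ) (□ψ∈a , cov) (assignment U))
        where
        refuted : Γ U ⊢ ¬' □ ψ → Γ U ⊢ □ ψ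
        refuted ⊢¬□ψ with existence (good U) cov ⊢¬□ψ
        ... | c , gc , ⊢¬ψ with good-accessible r gc
        ... | V , U⇝V , rV , refl =
          ⊥-elim (⊢-contradiction (consistent V) (to (IH rV) (h V U⇝V)) ⊢¬ψ)
      possible : Γ U ⊢ □ ψ → ⟦ 𝓦 ⟧ (□ ψ) σ U
      possible ⊢□ψ V U⇝V =
        from (IH (r ◅◅ (U⇝V ◅ ε))) (⇒-trans (transfer (good U) (good V) □ψ∈a is-□ ⊢□ψ) axT)

    truth-◇ : ◇ ψ ∈ᵥ a → ∀ {U} → Reachable 𝓦 W U → ⟦ 𝓦 ⟧ (◇ ψ) σ U ⇔ Γ U ⊢ ◇ ψ
    truth-◇ ◇ψ∈a {U} r = mk⇔ witnessed realized
      where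
      witnessed : ⟦ 𝓦 ⟧ (◇ ψ) σ U → Γ U ⊢ ◇ ψ
      witnessed (V , U⇝V , x) =
        transfer (good V) (good U) ◇ψ∈a is-◇ (⇒-trans (to (IH (r ◅◅ (U⇝V ◅ ε))) x) ◇-intro)
      realized : Γ U ⊢ ◇ ψ → ⟦ 𝓦 ⟧ (◇ ψ) σ U
      realized ⊢◇ψ with existence (good U) cov (⇒-trans ⊢◇ψ dual₁)
      ... | c , gc , ⊢¬¬ψ with good-accessible r gc
      ... | V , U⇝V , rV , refl = V , U⇝V , from (IH rV) (⇒-trans ⊢¬¬ψ (dne ψ))

  truth : ∀ ψ → OverAtoms ψ → ∀ {U} → Reachable 𝓦 W U → ⟦ 𝓦 ⟧ ψ σ U ⇔ Γ U ⊢ ψ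
  truth (var j)  _            r = σ-spec j
  truth ⊥'       _        {U} r = ⊢-⊥ (consistent U)
  truth (¬' ψ)   cov      {U} r = ⊢-¬ (consistent U) (decided ψ cov _) ⇔-∘ ¬-cong-⇔ (truth ψ cov r)
  truth (ψ ∧' χ) (cψ , cχ)    r = ⊢-∧ ⇔-∘ (truth ψ cψ r ×-⇔ truth χ cχ r)
  truth (ψ ∨' χ) (cψ , cχ)    r = ⊢-∨ (decided ψ cψ _) ⇔-∘ (truth ψ cψ r ⊎-⇔ truth χ cχ r)
  truth (ψ ⇒ χ)  (cψ , cχ)    r = ⊢-⇒ (decided ψ cψ _) ⇔-∘ →-cong-⇔ (truth ψ cψ r) (truth χ cχ r)
  truth (□ ψ)    (□ψ∈a , cov) r = truth-□ cov (truth ψ cov) □ψ∈a r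
  truth (◇ ψ)    (◇ψ∈a , cov) r = truth-◇ cov (truth ψ cov) ◇ψ∈a r

  refuted-not-valid : ∀ {φ} → OverAtoms φ → literals c₀ a ⊢ ¬' φ → ¬ ValidAt 𝓦 C W φ
  refuted-not-valid {φ} cov ⊢¬φ valid = ⊢-contradiction c₀-consistent ⊢φ ⊢¬φ
    where
    ⊢φ : literals c₀ a ⊢ φ
    ⊢φ = subst (λ c → literals c a ⊢ φ) assignment-W (to (truth φ cov ε) (valid σ σ∈C))

theorem3 : ExcludedMiddle 0ℓ →
    (𝓦 : KripkeModel) (W : KripkeModel.World 𝓦)
    (C : Assertion 𝓦 → Set₁) → BooleanClosed 𝓦 C →
    ((n : ℕ) → Σ (Fin n → Assertion 𝓦) λ s →
       IndependentSwitches 𝓦 s W × ((i : Fin n) → C (s i))) →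
    (φ : Form) → ValidAt 𝓦 C W φ → S5 φ
theorem3 em 𝓦 W C bc switches φ valid =
  provable-unless-refuted cov λ { c (consistent , ⊢¬φ) →
    let s , independent , sC = switches _ in
    CanonicalModel.refuted-not-valid em 𝓦 W C bc a c consistent s independent sC cov ⊢¬φ valid }
  where
  a = fromList (atoms φ)
  open Assignments a
  open Classical em
  cov : OverAtoms φ
  cov = allAtoms-mono ∈-fromList⁺ φ (allAtoms-∈-atoms φ)
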